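{- Let $\gamma_1,\gamma_2$ be partial graphs with $\gamma=\gamma_1\bullet\gamma_2$ defined, and suppose $\mathit{summits}\ \gamma\subseteq\mathit{loops}\ \gamma$. Then: (1) $\mathit{sinks}\ \gamma\subseteq\mathit{nodes}\ \gamma$; (2) $\mathit{cycles}\ \gamma\subseteq\mathit{loops}\ \gamma$; (3) $\mathit{summits}\ (\gamma_1\bullet\gamma_2)=(\mathit{summits}\ \gamma_1)\setminus\mathit{nodes}\ \gamma_2\ \uplus\ (\mathit{summits}\ \gamma_2)\setminus\mathit{nodes}\ \gamma_1$; (4) if $\gamma$ is unary, then for every $x\in\mathit{nodes}\ \gamma$, $\mathit{summit}\ \gamma\ x=\mathit{summit}\ \gamma\ (\gamma\,x)$, where $\gamma\,x$ denotes the unique child of $x$.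
   Context: A partial graph is a finite partial map $\gamma$ from nodes (natural numbers, undefined at $0$) to pairs (contents, adjacency list of nodes); $\mathit{nodes}\ \gamma$ is its domain, $\gamma_{adj}\,x$ the adjacency list (entries need not be in $\mathit{nodes}\ \gamma$). A unary graph has adjacency lists of exactly one element. $\gamma_1\bullet\gamma_2$ is union of maps with disjoint domains; $\gamma\setminus x$ is $\gamma$ restricted to $\mathit{nodes}\ \gamma\setminus\{x\}$. $\mathit{reach}\ \gamma\ x=\{x\}\cup\bigcup_{z\in\gamma_{adj}x}\mathit{reach}\ (\gamma\setminus x)\ z$ if $x\in\mathit{nodes}\ \gamma$, else $\emptyset$. $\mathit{sinks}\ \gamma=\bigcup_{x\in\mathit{nodes}\,\gamma}\gamma_{adj}\,x$; $\mathit{cycles}\ \gamma=\{x\mid x\in\bigcup_{y\in\gamma_{adj}x}\mathit{reach}\ \gamma\ y\}$; $\mathit{loops}\ \gamma=\{x\in\mathit{nodes}\ \gamma\mid x\in\gamma_{adj}\,x\}$. $\mathit{summit}\ \gamma\ x=\bigcup_{w\in\gamma_{adj}x}\mathit{summit}\ (\gamma\setminus x)\ w$ if $x\in\mathit{nodes}\ \gamma$, and $\{x\}$ otherwise; $\mathit{summits}\ \gamma=\bigcup_{x\in\mathit{nodes}\,\gamma}\mathit{summit}\ \gamma\ x$. -}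

module Defs where

open import Data.Nat using (ℕ; zero; suc; _≟_)
open import Data.Product using (_×_; _,_; proj₁; proj₂; Σ)
open import Data.Sum using (_⊎_)
open import Data.Empty using (⊥)
open import Data.Maybe using (Maybe; just; nothing; maybe′)
open import Data.Bool using (if_then_else_)
open import Data.List using (List; []; _∷_; [_]; map; filter; length; _++_)
open import Data.List.Relation.Unary.Any using (Any)
open import Data.List.Relation.Unary.All using (All)
open import Data.List.Membership.Propositional using (_∈_)
open import Data.List.Relation.Unary.Unique.Propositional using (Unique)
open import Relation.Nullary using (¬_; does; ¬?)
open import Relation.Binary.PropositionalEquality using (_≡_; _≢_)

NSet : Set₁
NSet = ℕ → Set

_⊆_ : NSet → NSet → Set
P ⊆ Q = ∀ x → P x → Q x

_≐_ : NSet → NSet → Set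
P ≐ Q = (P ⊆ Q) × (Q ⊆ P)

_∪ₛ_ : NSet → NSet → NSet
(P ∪ₛ Q) x = P x ⊎ Q x

_∖ₛ_ : NSet → NSet → NSet
(P ∖ₛ Q) x = P x × ¬ Q x

DisjointSets : NSet → NSet → Set
DisjointSets P Q = ∀ x → P x → Q x → ⊥

-- A (raw) partial graph with contents of type A: an association list
-- node ↦ (contents , adjacency list).
Graph : Set → Set
Graph A = List (ℕ × A × List ℕ)

module _ {A : Set} where

  keys : Graph A → List ℕ
  keys = map proj₁

  -- well-formed: a finite partial map (keys distinct), undefined at 0
  WF : Graph A → Set
  WF γ = Unique (keys γ) × All (λ k → k ≢ 0) (keys γ)

  nodes : Graph A → NSet
  nodes γ x = x ∈ keys γ

  lookup : Graph A → ℕ → Maybe (A × List ℕ)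
  lookup [] x = nothing
  lookup ((k , v) ∷ γ) x = if does (k ≟ x) then just v else lookup γ x

  -- adjacency list γ_adj x (empty when x ∉ nodes γ)
  adj : Graph A → ℕ → List ℕ
  adj γ x = maybe′ proj₂ [] (lookup γ x)

  _∖_ : Graph A → ℕ → Graph A
  γ ∖ x = filter (λ e → ¬? (proj₁ e ≟ x)) γ

  -- γ₁ • γ₂ (defined when the domains are disjoint)
  _•_ : Graph A → Graph A → Graph A
  γ₁ • γ₂ = γ₁ ++ γ₂

  DisjointDom : Graph A → Graph A → Set
  DisjointDom γ₁ γ₂ = DisjointSets (nodes γ₁) (nodes γ₂)

  -- reach, with fuel (fuel ≥ number of nodes makes it exact)
  reachF : ℕ → Graph A → ℕ → NSet
  reachF zero γ x y = ⊥
  reachF (suc n) γ x y =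
    nodes γ x × (y ≡ x ⊎ Any (λ z → reachF n (γ ∖ x) z y) (adj γ x))

  reach : Graph A → ℕ → NSet
  reach γ = reachF (length γ) γ

  sinks : Graph A → NSet
  sinks γ y = Σ ℕ λ x → nodes γ x × y ∈ adj γ x

  cycles : Graph A → NSet
  cycles γ x = Any (λ y → reach γ y x) (adj γ x)

  loops : Graph A → NSet
  loops γ x = nodes γ x × x ∈ adj γ x

  -- summit, with fuel (fuel ≥ number of nodes makes it exact)
  summitF : ℕ → Graph A → ℕ → NSet
  summitF zero γ x y = y ≡ x
  summitF (suc n) γ x y =
    (nodes γ x × Any (λ w → summitF n (γ ∖ x) w y) (adj γ x))
    ⊎ (¬ nodes γ x × y ≡ x)

  summit : Graph A → ℕ → NSet
  summit γ = summitF (length γ) γ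

  summits : Graph A → NSet
  summits γ y = Σ ℕ λ x → nodes γ x × summit γ x y

  Unary : Graph A → Set
  Unary γ = ∀ x → nodes γ x → Σ ℕ λ c → adj γ x ≡ [ c ]

{-# OPTIONS --safe #-}
module Submission where

-- A path from a child of x back to x becomes, once x is deleted, a summit path ending at x,
-- so x is its own summit; hence when summits are loops, every node on a cycle is a loop (2).
-- A child that is not a node is a summit of its parent, hence a loop, hence a node (1).
-- For a unary x with child c ≠ x, c cannot reach x (x would be a loop, forcing c = x), so
-- deleting x leaves the summits of c unchanged (4). Summit paths of one component that end
-- outside the other lift to γ₁ • γ₂; conversely a summit of γ₁ • γ₂ is a loop, hence its
-- own summit in the component containing it (3).

open import Defs
open import Data.Nat using (ℕ; zero; suc; _≟_; _≤_; _<_)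
open import Data.Nat.Properties using (≤-refl; <-≤-trans; ≤-pred; n≮0)
open import Data.Product using (_×_; _,_; proj₁; proj₂)
open import Data.Sum using (_⊎_; inj₁; inj₂)
import Data.Sum as Sum
open import Data.Empty using (⊥-elim)
open import Data.List using ([]; _∷_; [_]; length; filter)
open import Data.List.Properties using (filter-accept; filter-reject; filter-++; filter-notAll; map-++)
open import Data.List.Relation.Unary.Any using (Any; here; there)
open import Data.List.Relation.Unary.Any.Properties using (singleton⁻; map⁻)
import Data.List.Relation.Unary.Any as Any
open import Data.List.Membership.Propositional using (_∈_; find; lose)
open import Data.List.Membership.Propositional.Properties
  using (∈-map⁺; ∈-map⁻; ∈-map∘filter⁺; ∈-map∘filter⁻; ∈-++⁻; ∈-++⁺ˡ; ∈-++⁺ʳ)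
open import Data.List.Membership.DecPropositional _≟_ using (_∈?_)
open import Function using (_∘_)
open import Relation.Nullary using (¬_; yes; no; ¬?)
open import Relation.Nullary.Decidable using (dec-true; dec-false)
open import Relation.Unary using (Pred; Decidable)
open import Relation.Binary.PropositionalEquality
  using (_≡_; _≢_; _≗_; refl; sym; cong; subst)

filter-comm : ∀ {a p q} {X : Set a} {P : Pred X p} {Q : Pred X q}
              (P? : Decidable P) (Q? : Decidable Q) →
              filter P? ∘ filter Q? ≗ filter Q? ∘ filter P?
filter-comm P? Q? [] = refl
filter-comm P? Q? (x ∷ xs) with P? x | Q? x
... | yes p | yes q rewrite filter-accept P? {xs = filter Q? xs} p
                          | filter-accept Q? {xs = filter P? xs} q = cong (x ∷_) (filter-comm P? Q? xs)
... | yes p | no ¬q rewrite filter-reject Q? {xs = filter P? xs} ¬q = filter-comm P? Q? xs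
... | no ¬p | yes q rewrite filter-reject P? {xs = filter Q? xs} ¬p = filter-comm P? Q? xs
... | no ¬p | no ¬q = filter-comm P? Q? xs

module _ {A : Set} where

  ∷-∖-≡ : ∀ {k x : ℕ} {v} (γ : Graph A) → k ≡ x → ((k , v) ∷ γ) ∖ x ≡ γ ∖ x
  ∷-∖-≡ γ k≡x = filter-reject (λ e → ¬? (proj₁ e ≟ _)) (λ k≢x → k≢x k≡x)

  ∷-∖-≢ : ∀ {k x : ℕ} {v} (γ : Graph A) → k ≢ x → ((k , v) ∷ γ) ∖ x ≡ (k , v) ∷ (γ ∖ x)
  ∷-∖-≢ γ = filter-accept (λ e → ¬? (proj₁ e ≟ _))

  adj-∷-≡ : ∀ {k x : ℕ} {v} (γ : Graph A) → k ≡ x → adj ((k , v) ∷ γ) x ≡ proj₂ v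
  adj-∷-≡ {k} {x} γ k≡x rewrite dec-true (k ≟ x) k≡x = refl

  adj-∷-≢ : ∀ {k x : ℕ} {v} (γ : Graph A) → k ≢ x → adj ((k , v) ∷ γ) x ≡ adj γ x
  adj-∷-≢ {k} {x} γ k≢x rewrite dec-false (k ≟ x) k≢x = refl

  nodes? : (γ : Graph A) → Decidable (nodes γ)
  nodes? γ x = x ∈? keys γ

  ∈-adj⇒nodes : (γ : Graph A) {x w : ℕ} → w ∈ adj γ x → nodes γ x
  ∈-adj⇒nodes ((k , v) ∷ γ) {x} w∈adj with k ≟ x
  ... | yes k≡x = here (sym k≡x)
  ... | no k≢x = there (∈-adj⇒nodes γ (subst (_ ∈_) (adj-∷-≢ γ k≢x) w∈adj))

  nodes-∖⁻ : (γ : Graph A) {x z : ℕ} → nodes (γ ∖ x) z → nodes γ z × z ≢ x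
  nodes-∖⁻ γ z∈ with ∈-map∘filter⁻ proj₁ (λ e → ¬? (proj₁ e ≟ _)) {xs = γ} z∈
  ... | e , e∈γ , refl , k≢x = ∈-map⁺ proj₁ e∈γ , k≢x

  nodes-∖⁺ : (γ : Graph A) {x z : ℕ} → nodes γ z → z ≢ x → nodes (γ ∖ x) z
  nodes-∖⁺ γ z∈ z≢x with ∈-map⁻ proj₁ z∈
  ... | e , e∈γ , refl = ∈-map∘filter⁺ proj₁ (λ e → ¬? (proj₁ e ≟ _)) (e , e∈γ , refl , z≢x)

  ∉-∖ : (γ : Graph A) (x : ℕ) → ¬ nodes (γ ∖ x) x
  ∉-∖ γ x x∈ = proj₂ (nodes-∖⁻ γ x∈) refl

  adj-∖ : (γ : Graph A) {x z : ℕ} → z ≢ x → adj (γ ∖ x) z ≡ adj γ z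
  adj-∖ [] _ = refl
  adj-∖ ((k , v) ∷ γ) {x} {z} z≢x with k ≟ x | k ≟ z
  ... | yes refl | yes refl = ⊥-elim (z≢x refl)
  ... | yes k≡x | no k≢z rewrite ∷-∖-≡ {v = v} γ k≡x | adj-∷-≢ {v = v} γ k≢z = adj-∖ γ z≢x
  ... | no k≢x | yes k≡z rewrite ∷-∖-≢ {v = v} γ k≢x
                               | adj-∷-≡ {v = v} (γ ∖ x) k≡z | adj-∷-≡ {v = v} γ k≡z = refl
  ... | no k≢x | no k≢z rewrite ∷-∖-≢ {v = v} γ k≢x
                              | adj-∷-≢ {v = v} (γ ∖ x) k≢z | adj-∷-≢ {v = v} γ k≢z = adj-∖ γ z≢x

  ∖-comm : (γ : Graph A) (x z : ℕ) → (γ ∖ x) ∖ z ≡ (γ ∖ z) ∖ x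
  ∖-comm γ x z = filter-comm (λ e → ¬? (proj₁ e ≟ z)) (λ e → ¬? (proj₁ e ≟ x)) γ

  length-∖< : (γ : Graph A) {x : ℕ} → nodes γ x → length (γ ∖ x) < length γ
  length-∖< γ x∈ = filter-notAll (λ e → ¬? (proj₁ e ≟ _)) γ
    (Any.map (λ x≡k k≢x → k≢x (sym x≡k)) (map⁻ x∈))

  ∖-• : (γ₁ γ₂ : Graph A) (x : ℕ) → (γ₁ • γ₂) ∖ x ≡ (γ₁ ∖ x) • (γ₂ ∖ x)
  ∖-• γ₁ γ₂ x = filter-++ (λ e → ¬? (proj₁ e ≟ x)) γ₁ γ₂

  nodes-•⁻ : (γ₁ γ₂ : Graph A) {x : ℕ} → nodes (γ₁ • γ₂) x → nodes γ₁ x ⊎ nodes γ₂ x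
  nodes-•⁻ γ₁ γ₂ x∈ = ∈-++⁻ (keys γ₁) (subst (_ ∈_) (map-++ proj₁ γ₁ γ₂) x∈)

  nodes-•ˡ : (γ₁ γ₂ : Graph A) {x : ℕ} → nodes γ₁ x → nodes (γ₁ • γ₂) x
  nodes-•ˡ γ₁ γ₂ x∈ = subst (_ ∈_) (sym (map-++ proj₁ γ₁ γ₂)) (∈-++⁺ˡ x∈)

  nodes-•ʳ : (γ₁ γ₂ : Graph A) {x : ℕ} → nodes γ₂ x → nodes (γ₁ • γ₂) x
  nodes-•ʳ γ₁ γ₂ x∈ = subst (_ ∈_) (sym (map-++ proj₁ γ₁ γ₂)) (∈-++⁺ʳ (keys γ₁) x∈)

  adj-•ˡ : (γ₁ γ₂ : Graph A) {x : ℕ} → nodes γ₁ x → adj (γ₁ • γ₂) x ≡ adj γ₁ x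
  adj-•ˡ ((k , v) ∷ γ₁) γ₂ {x} x∈ with k ≟ x | x∈
  ... | yes k≡x | _ rewrite adj-∷-≡ {v = v} (γ₁ • γ₂) k≡x | adj-∷-≡ {v = v} γ₁ k≡x = refl
  ... | no k≢x | here x≡k = ⊥-elim (k≢x (sym x≡k))
  ... | no k≢x | there x∈γ₁
    rewrite adj-∷-≢ {v = v} (γ₁ • γ₂) k≢x | adj-∷-≢ {v = v} γ₁ k≢x = adj-•ˡ γ₁ γ₂ x∈γ₁

  adj-•ʳ : (γ₁ γ₂ : Graph A) {x : ℕ} → ¬ nodes γ₁ x → adj (γ₁ • γ₂) x ≡ adj γ₂ x
  adj-•ʳ [] γ₂ _ = refl
  adj-•ʳ ((k , v) ∷ γ₁) γ₂ {x} x∉ with k ≟ x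
  ... | yes k≡x = ⊥-elim (x∉ (here (sym k≡x)))
  ... | no k≢x rewrite adj-∷-≢ {v = v} (γ₁ • γ₂) k≢x = adj-•ʳ γ₁ γ₂ (x∉ ∘ there)

  data Summit : Graph A → ℕ → NSet where
    outside : ∀ {γ x} → ¬ nodes γ x → Summit γ x x
    step    : ∀ {γ x w y} → w ∈ adj γ x → Summit (γ ∖ x) w y → Summit γ x y

  data Reach : Graph A → ℕ → NSet where
    done : ∀ {γ x} → nodes γ x → Reach γ x x
    step : ∀ {γ x w y} → w ∈ adj γ x → Reach (γ ∖ x) w y → Reach γ x y

  summitF⇒Summit : ∀ n {γ : Graph A} {x y} → length γ ≤ n → summitF n γ x y → Summit γ x y
  summitF⇒Summit zero {[]} _ refl = outside (λ ())
  summitF⇒Summit (suc n) _ (inj₂ (x∉γ , refl)) = outside x∉γ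
  summitF⇒Summit (suc n) {γ} γ≤1+n (inj₁ (x∈γ , summits-of-children)) =
    let w , w∈adj , s = find summits-of-children
    in step w∈adj (summitF⇒Summit n (≤-pred (<-≤-trans (length-∖< γ x∈γ) γ≤1+n)) s)

  Summit⇒summitF : ∀ n {γ : Graph A} {x y} → length γ ≤ n → Summit γ x y → summitF n γ x y
  Summit⇒summitF zero _ (outside _) = refl
  Summit⇒summitF (suc n) _ (outside x∉γ) = inj₂ (x∉γ , refl)
  Summit⇒summitF zero {γ} γ≤0 (step w∈adj _) =
    ⊥-elim (n≮0 (<-≤-trans (length-∖< γ (∈-adj⇒nodes γ w∈adj)) γ≤0))
  Summit⇒summitF (suc n) {γ} γ≤1+n (step w∈adj s) =
    let x∈γ = ∈-adj⇒nodes γ w∈adj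
    in inj₁ (x∈γ , lose w∈adj (Summit⇒summitF n (≤-pred (<-≤-trans (length-∖< γ x∈γ) γ≤1+n)) s))

  summit⇒Summit : ∀ {γ : Graph A} {x y} → summit γ x y → Summit γ x y
  summit⇒Summit = summitF⇒Summit _ ≤-refl

  Summit⇒summit : ∀ {γ : Graph A} {x y} → Summit γ x y → summit γ x y
  Summit⇒summit = Summit⇒summitF _ ≤-refl

  reachF⇒Reach : ∀ n {γ : Graph A} {x y} → reachF n γ x y → Reach γ x y
  reachF⇒Reach (suc n) (x∈γ , inj₁ refl) = done x∈γ
  reachF⇒Reach (suc n) (x∈γ , inj₂ reaches-from-children) =
    let w , w∈adj , r = find reaches-from-children in step w∈adj (reachF⇒Reach n r)

  Reach⇒nodes : ∀ {γ : Graph A} {x y} → Reach γ x y → nodes γ y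
  Reach⇒nodes (done y∈γ) = y∈γ
  Reach⇒nodes {γ} (step _ r) = proj₁ (nodes-∖⁻ γ (Reach⇒nodes r))

  loop⇒Summit : ∀ {γ : Graph A} {x} → loops γ x → Summit γ x x
  loop⇒Summit {γ} {x} (_ , x∈adj) = step x∈adj (outside (∉-∖ γ x))

  Summit-step⁻ : ∀ {γ : Graph A} {x y} → nodes γ x → Summit γ x y →
                 Any (λ w → Summit (γ ∖ x) w y) (adj γ x)
  Summit-step⁻ x∈γ (outside x∉γ) = ⊥-elim (x∉γ x∈γ)
  Summit-step⁻ _ (step w∈adj s) = lose w∈adj s

  Reach⇒Summit-∖ : ∀ {γ : Graph A} {x y} → Reach γ x y → Summit (γ ∖ y) x y
  Reach⇒Summit-∖ {γ} {y = y} (done _) = outside (∉-∖ γ y)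
  Reach⇒Summit-∖ {γ} {x} {y} (step {w = w} w∈adj r) =
    step (subst (w ∈_) (sym (adj-∖ γ x≢y)) w∈adj)
         (subst (λ δ → Summit δ w y) (∖-comm γ x y) (Reach⇒Summit-∖ r))
    where
    x≢y : x ≢ y
    x≢y x≡y = proj₂ (nodes-∖⁻ γ (Reach⇒nodes r)) (sym x≡y)

  Summit-∖⁺ : ∀ {γ : Graph A} {x y z} → ¬ Reach γ x z → Summit γ x y → Summit (γ ∖ z) x y
  Summit-∖⁺ {γ} _ (outside x∉γ) = outside (x∉γ ∘ proj₁ ∘ nodes-∖⁻ γ)
  Summit-∖⁺ {γ} {x} {y} {z} ¬x⇝z (step {w = w} w∈adj s) =
    step (subst (w ∈_) (sym (adj-∖ γ x≢z)) w∈adj)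
         (subst (λ δ → Summit δ w y) (∖-comm γ x z) (Summit-∖⁺ (¬x⇝z ∘ step w∈adj) s))
    where
    x≢z : x ≢ z
    x≢z refl = ¬x⇝z (done (∈-adj⇒nodes γ w∈adj))

  Summit-∖⁻ : ∀ {γ : Graph A} {x y z} → ¬ Reach γ x z → Summit (γ ∖ z) x y → Summit γ x y
  Summit-∖⁻ ¬x⇝z s = unrestrict s refl ¬x⇝z
    where
    -- The equation keeps the recursion structural: the subderivation lives in (γ ∖ z) ∖ x,
    -- which equals (γ ∖ x) ∖ z only propositionally.
    unrestrict : ∀ {δ γ : Graph A} {x y z} → Summit δ x y → δ ≡ γ ∖ z → ¬ Reach γ x z → Summit γ x y
    unrestrict {γ = γ} {x} {z = z} (outside x∉γ∖z) refl ¬x⇝z = outside x∉γ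
      where
      x∉γ : ¬ nodes γ x
      x∉γ x∈γ with x ≟ z
      ... | yes refl = ¬x⇝z (done x∈γ)
      ... | no x≢z = x∉γ∖z (nodes-∖⁺ γ x∈γ x≢z)
    unrestrict {γ = γ} {x} {z = z} (step {w = w} w∈adj s) refl ¬x⇝z =
      step w∈adj′ (unrestrict s (∖-comm γ z x) (¬x⇝z ∘ step w∈adj′))
      where
      w∈adj′ : w ∈ adj γ x
      w∈adj′ = subst (w ∈_) (adj-∖ γ (proj₂ (nodes-∖⁻ γ (∈-adj⇒nodes (γ ∖ z) w∈adj)))) w∈adj

  Summit-•ˡ : ∀ {γ₁ : Graph A} γ₂ {x y} → ¬ nodes γ₂ y → Summit γ₁ x y → Summit (γ₁ • γ₂) x y
  Summit-•ˡ {γ₁} γ₂ y∉γ₂ (outside y∉γ₁) = outside (Sum.[ y∉γ₁ , y∉γ₂ ] ∘ nodes-•⁻ γ₁ γ₂)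
  Summit-•ˡ {γ₁} γ₂ {x} {y} y∉γ₂ (step {w = w} w∈adj s) =
    step (subst (w ∈_) (sym (adj-•ˡ γ₁ γ₂ (∈-adj⇒nodes γ₁ w∈adj))) w∈adj)
         (subst (λ δ → Summit δ w y) (sym (∖-• γ₁ γ₂ x))
                (Summit-•ˡ (γ₂ ∖ x) (y∉γ₂ ∘ proj₁ ∘ nodes-∖⁻ γ₂) s))

  Summit-•ʳ : ∀ γ₁ {γ₂ : Graph A} {x y} → DisjointDom γ₁ γ₂ → ¬ nodes γ₁ y →
              Summit γ₂ x y → Summit (γ₁ • γ₂) x y
  Summit-•ʳ γ₁ {γ₂} _ y∉γ₁ (outside y∉γ₂) = outside (Sum.[ y∉γ₁ , y∉γ₂ ] ∘ nodes-•⁻ γ₁ γ₂)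
  Summit-•ʳ γ₁ {γ₂} {x} {y} disjoint y∉γ₁ (step {w = w} w∈adj s) =
    step (subst (w ∈_) (sym (adj-•ʳ γ₁ γ₂ x∉γ₁)) w∈adj)
         (subst (λ δ → Summit δ w y) (sym (∖-• γ₁ γ₂ x))
                (Summit-•ʳ (γ₁ ∖ x) disjoint′ (y∉γ₁ ∘ proj₁ ∘ nodes-∖⁻ γ₁) s))
    where
    x∉γ₁ : ¬ nodes γ₁ x
    x∉γ₁ x∈γ₁ = disjoint x x∈γ₁ (∈-adj⇒nodes γ₂ w∈adj)
    disjoint′ : DisjointDom (γ₁ ∖ x) (γ₂ ∖ x)
    disjoint′ z z∈γ₁ z∈γ₂ = disjoint z (proj₁ (nodes-∖⁻ γ₁ z∈γ₁)) (proj₁ (nodes-∖⁻ γ₂ z∈γ₂))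

  loop⇒summits : ∀ {γ : Graph A} {x} → loops γ x → summits γ x
  loop⇒summits x-loop = _ , proj₁ x-loop , Summit⇒summit (loop⇒Summit x-loop)

  module _ {γ : Graph A} (summits⊆loops : summits γ ⊆ loops γ) where

    Summit⇒loop : ∀ {x y} → nodes γ x → Summit γ x y → loops γ y
    Summit⇒loop {x} {y} x∈γ s = summits⊆loops y (x , x∈γ , Summit⇒summit s)

    sinks⊆nodes : sinks γ ⊆ nodes γ
    sinks⊆nodes y (x , x∈γ , y∈adj) with nodes? γ y
    ... | yes y∈γ = y∈γ
    ... | no y∉γ = proj₁ (Summit⇒loop x∈γ (step y∈adj (outside (y∉γ ∘ proj₁ ∘ nodes-∖⁻ γ))))

    cycle⇒loop : ∀ {x w} → w ∈ adj γ x → Reach γ w x → loops γ x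
    cycle⇒loop w∈adj w⇝x = Summit⇒loop (∈-adj⇒nodes γ w∈adj) (step w∈adj (Reach⇒Summit-∖ w⇝x))

    cycles⊆loops : cycles γ ⊆ loops γ
    cycles⊆loops x x-cycle =
      let w , w∈adj , w⇝x = find x-cycle in cycle⇒loop w∈adj (reachF⇒Reach _ w⇝x)

    summit-child : ∀ {x c} → nodes γ x → adj γ x ≡ [ c ] → summit γ x ≐ summit γ c
    summit-child {x} {c} x∈γ adj≡[c] with c ≟ x
    ... | yes refl = (λ _ s → s) , (λ _ s → s)
    ... | no c≢x =
          (λ _ → Summit⇒summit ∘ Summit-∖⁻ ¬c⇝x ∘ through-c ∘ summit⇒Summit)
        , (λ _ → Summit⇒summit ∘ step c∈adj ∘ Summit-∖⁺ ¬c⇝x ∘ summit⇒Summit)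
      where
      c∈adj : c ∈ adj γ x
      c∈adj = subst (c ∈_) (sym adj≡[c]) (here refl)
      ¬c⇝x : ¬ Reach γ c x
      ¬c⇝x c⇝x = c≢x (sym (singleton⁻ (subst (x ∈_) adj≡[c] (proj₂ (cycle⇒loop c∈adj c⇝x)))))
      through-c : ∀ {y} → Summit γ x y → Summit (γ ∖ x) c y
      through-c = singleton⁻ ∘ subst (Any _) adj≡[c] ∘ Summit-step⁻ x∈γ

  module _ {γ₁ γ₂ : Graph A} (disjoint : DisjointDom γ₁ γ₂) where

    summits-•⁺ : ((summits γ₁ ∖ₛ nodes γ₂) ∪ₛ (summits γ₂ ∖ₛ nodes γ₁)) ⊆ summits (γ₁ • γ₂)
    summits-•⁺ y (inj₁ ((x , x∈γ₁ , s) , y∉γ₂)) =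
      x , nodes-•ˡ γ₁ γ₂ x∈γ₁ , Summit⇒summit (Summit-•ˡ γ₂ y∉γ₂ (summit⇒Summit s))
    summits-•⁺ y (inj₂ ((x , x∈γ₂ , s) , y∉γ₁)) =
      x , nodes-•ʳ γ₁ γ₂ x∈γ₂ , Summit⇒summit (Summit-•ʳ γ₁ disjoint y∉γ₁ (summit⇒Summit s))

    module _ (summits⊆loops : summits (γ₁ • γ₂) ⊆ loops (γ₁ • γ₂)) where

      summits-•⁻ : summits (γ₁ • γ₂) ⊆ ((summits γ₁ ∖ₛ nodes γ₂) ∪ₛ (summits γ₂ ∖ₛ nodes γ₁))
      summits-•⁻ y y-summit with summits⊆loops y y-summit
      ... | y∈γ , y∈adj with nodes-•⁻ γ₁ γ₂ y∈γ
      ... | inj₁ y∈γ₁ =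
            inj₁ (loop⇒summits (y∈γ₁ , subst (y ∈_) (adj-•ˡ γ₁ γ₂ y∈γ₁) y∈adj) , disjoint y y∈γ₁)
      ... | inj₂ y∈γ₂ =
            inj₂ (loop⇒summits (y∈γ₂ , subst (y ∈_) (adj-•ʳ γ₁ γ₂ y∉γ₁) y∈adj) , y∉γ₁)
        where
        y∉γ₁ : ¬ nodes γ₁ y
        y∉γ₁ y∈γ₁ = disjoint y y∈γ₁ y∈γ₂

      summits-disjoint : DisjointSets (summits γ₁ ∖ₛ nodes γ₂) (summits γ₂ ∖ₛ nodes γ₁)
      summits-disjoint y left (_ , y∉γ₁) =
        Sum.[ y∉γ₁ , proj₂ left ] (nodes-•⁻ γ₁ γ₂ (proj₁ (summits⊆loops y (summits-•⁺ y (inj₁ left)))))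

lemmaE4 : {A : Set} (γ₁ γ₂ : Graph A) →
          WF γ₁ → WF γ₂ → DisjointDom γ₁ γ₂ →
          summits (γ₁ • γ₂) ⊆ loops (γ₁ • γ₂) →
          (sinks (γ₁ • γ₂) ⊆ nodes (γ₁ • γ₂))
          × (cycles (γ₁ • γ₂) ⊆ loops (γ₁ • γ₂))
          × (summits (γ₁ • γ₂) ≐ ((summits γ₁ ∖ₛ nodes γ₂) ∪ₛ (summits γ₂ ∖ₛ nodes γ₁)))
          × DisjointSets (summits γ₁ ∖ₛ nodes γ₂) (summits γ₂ ∖ₛ nodes γ₁)
          × (Unary (γ₁ • γ₂) → ∀ x c → nodes (γ₁ • γ₂) x → adj (γ₁ • γ₂) x ≡ [ c ] →
              summit (γ₁ • γ₂) x ≐ summit (γ₁ • γ₂) c)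
lemmaE4 γ₁ γ₂ _ _ disjoint summits⊆loops =
    sinks⊆nodes summits⊆loops
  , cycles⊆loops summits⊆loops
  , (summits-•⁻ disjoint summits⊆loops , summits-•⁺ disjoint)
  , summits-disjoint disjoint summits⊆loops
  , λ _ _ _ → summit-child summits⊆loops
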